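{- Let $G$ be a graph with edge weights $w:E(G)\to\mathbb{N}$ and a total order on $V(G)$. For any two lex shortest paths $lsp(x,y)$ and $lsp(u,v)$ in $G$, the graph with vertex set $V(lsp(x,y))\cap V(lsp(u,v))$ and edge set $E(lsp(x,y))\cap E(lsp(u,v))$ is either empty or a lex shortest path of $G$.
   Context: For a path $P$, $w(P)=\sum_{e\in E(P)}w(e)$. A $u$–$v$ path $P$ ($u\neq v$) is lex shortest if for every other $u$–$v$ path $P'$ exactly one of: (1) $w(P')>w(P)$; (2) $w(P')=w(P)$ and $|E(P')|>|E(P)|$; (3) $w(P')=w(P)$, $|E(P')|=|E(P)|$ and $\min(V(P')\setminus V(P))>\min(V(P)\setminus V(P'))$. It is unique and denoted $lsp(u,v)$. Graphs are simple, finite, connected and undirected. -}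

module Defs where

open import Data.Nat using (ℕ; zero; suc; _+_)
import Data.Nat as ℕ
open import Data.Fin using (Fin)
import Data.Fin as F
open import Data.List using (List; []; _∷_; map; length)
open import Data.Nat.ListAction using (sum)
open import Data.List.Membership.Propositional using (_∈_; _∉_)
open import Data.List.Relation.Unary.All using (All)
open import Data.List.Relation.Unary.Unique.Propositional using (Unique)
open import Data.Product using (Σ; ∃; ∃₂; _×_; _,_)
open import Data.Sum using (_⊎_)
open import Relation.Nullary using (¬_)
open import Relation.Binary.PropositionalEquality using (_≡_; _≢_)

infix 2 _⟺_
_⟺_ : Set → Set → Set
A ⟺ B = (A → B) × (B → A)

-- A finite simple undirected graph on vertex set Fin n.
-- The total order on V(G) is the standard order of Fin n.
record Graph (n : ℕ) : Set₁ where
  field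
    Adj    : Fin n → Fin n → Set
    irrefl : ∀ a → ¬ Adj a a
    sym    : ∀ {a b} → Adj a b → Adj b a
open Graph public

module _ {n : ℕ} where

  pairs : List (Fin n) → List (Fin n × Fin n)
  pairs (x ∷ y ∷ xs) = (x , y) ∷ pairs (y ∷ xs)
  pairs _            = []

  data StartsAt (u : Fin n) : List (Fin n) → Set where
    start : ∀ xs → StartsAt u (u ∷ xs)

  data EndsAt (v : Fin n) : List (Fin n) → Set where
    end-here : EndsAt v (v ∷ [])
    end-later : ∀ {x xs} → EndsAt v xs → EndsAt v (x ∷ xs)

  IsPath : Graph n → Fin n → Fin n → List (Fin n) → Set
  IsPath G u v P =
    StartsAt u P × EndsAt v P × Unique P
    × All (λ e → Adj G (Data.Product.proj₁ e) (Data.Product.proj₂ e)) (pairs P)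

  Connected : Graph n → Set
  Connected G = ∀ a b → ∃ λ P → IsPath G a b P

  weight : (Fin n → Fin n → ℕ) → List (Fin n) → ℕ
  weight w P = sum (map (λ e → w (Data.Product.proj₁ e) (Data.Product.proj₂ e)) (pairs P))

  numEdges : List (Fin n) → ℕ
  numEdges P = length (pairs P)

  EdgeIn : Fin n → Fin n → List (Fin n) → Set
  EdgeIn a b P = ((a , b) ∈ pairs P) ⊎ ((b , a) ∈ pairs P)

  IsMin : (Fin n → Set) → Fin n → Set
  IsMin S m = S m × (∀ s → S s → m F.≤ s)

  -- P' loses against P: one of the conditions (1),(2),(3)
  LexWorse : (Fin n → Fin n → ℕ) → List (Fin n) → List (Fin n) → Set
  LexWorse w P P' =
    (weight w P ℕ.< weight w P')
    ⊎ (weight w P ≡ weight w P' × numEdges P ℕ.< numEdges P')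
    ⊎ (weight w P ≡ weight w P' × numEdges P ≡ numEdges P'
       × ∃₂ λ a b → IsMin (λ z → z ∈ P' × z ∉ P) a
                  × IsMin (λ z → z ∈ P × z ∉ P') b
                  × b F.< a)

  IsLSP : Graph n → (Fin n → Fin n → ℕ) → Fin n → Fin n → List (Fin n) → Set
  IsLSP G w u v P =
    u ≢ v × IsPath G u v P
    × (∀ P' → IsPath G u v P' → P' ≢ P → LexWorse w P P')

module Submission where

-- A subpath T of a lex shortest path P is itself lex shortest. Replace T in P by a competitor S
-- with the same ends: the resulting walk is either a path, which P beats, or it shortcuts to a
-- path with no more weight and fewer edges, which P beats at least weakly. In either case the
-- comparison passes to T versus S: the common context adds the same weight and the same number
-- of edges to both sides, and when both sides are paths it contains no vertex of S or T.
-- With symmetric weights, reversing a lex shortest path also gives one.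
--
-- Now let a and b be the first and last vertices of P on Q, so that P = L₁ ++ R ++ L₂ with R
-- running from a to b and L₁, L₂ avoiding Q. If a = b then R = [a]. Otherwise R = lsp(a,b),
-- while the stretch of Q between a and b is lsp(a,b) or lsp(b,a); by uniqueness R is that
-- stretch or its reverse, so R lies in Q, and the vertices and edges P shares with Q are
-- exactly those of R.

open import Defs renaming (sym to Adj-sym)
open import Data.Nat using (ℕ; _+_; _≤_; _<_; z≤n; s≤s)
open import Data.Nat.Properties
  using (≤-refl; ≤-reflexive; ≤-trans; <-trans; <-irrefl; <-asym; <⇒≤; <-≤-trans; ≤-<-trans;
         m≤n⇒m<n∨m≡n; m≤n+m; +-identityʳ; +-monoˡ-<; +-cancelʳ-<; +-cancelʳ-≡; +-commutativeSemigroup)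
open import Algebra.Properties.CommutativeSemigroup +-commutativeSemigroup using (x∙yz≈y∙xz)
open import Data.Nat.Induction using (<-wellFounded)
open import Data.Nat.ListAction using (sum)
open import Data.Nat.ListAction.Properties using (sum-++; sum-↭)
open import Data.Fin using (Fin; _≟_)
open import Data.List using (List; []; _∷_; _++_; _∷ʳ_; [_]; map; length; reverse)
open import Data.List.Properties
  using (++-assoc; map-++; length-++; length-map; length-reverse; map-∘; map-cong-local;
         reverse-map; reverse-involutive; unfold-reverse; ++-cancelˡ; ++-cancelʳ; ≡-dec)
open import Data.List.Membership.Propositional using (_∈_; _∉_; lose)
open import Data.List.Membership.Propositional.Properties using (∈-++⁺ˡ; ∈-++⁺ʳ; ∈-++⁻; ∈-∃++; ∈-map⁻)
open import Data.List.Relation.Unary.Any using (Any; here; there; any?; toSum)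
import Data.List.Relation.Unary.Any.Properties as Any
open import Data.List.Relation.Unary.All as All using (All; []; _∷_)
open import Data.List.Relation.Unary.All.Properties using (¬Any⇒All¬; ++⁺; ++⁻)
open import Data.List.Relation.Unary.AllPairs using ([]; _∷_)
open import Data.List.Relation.Unary.Unique.Propositional using (Unique)
open import Data.List.Relation.Unary.Unique.Propositional.Properties using (Unique[x∷xs]⇒x∉xs)
open import Data.List.Relation.Binary.Disjoint.Propositional using (Disjoint)
open import Data.List.Relation.Binary.Permutation.Propositional using (_↭_; ↭-sym; ↭⇒↭ₛ)
open import Data.List.Relation.Binary.Permutation.Propositional.Properties using (↭-reverse; shifts; ∈-resp-↭)
import Data.List.Relation.Binary.Permutation.Setoid.Properties as PermutationSetoid
open import Data.Product using (Σ; ∃; ∃₂; _×_; _,_; proj₁; proj₂; swap)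
import Data.Product as Product
open import Data.Sum using (_⊎_; inj₁; inj₂; [_,_]′)
import Data.Sum as Sum
open import Data.Empty using (⊥; ⊥-elim)
open import Function using (_∘_)
open import Induction.WellFounded using (Acc; acc)
open import Relation.Nullary using (¬_; yes; no)
open import Relation.Binary.PropositionalEquality
  using (_≡_; _≢_; refl; sym; trans; cong; subst; subst₂; setoid; module ≡-Reasoning)

module _ {n : ℕ} where
  open import Data.List.Membership.DecPropositional (_≟_ {n}) using (_∈?_)

  private
    V = Fin n

  Segment : V → V → List V → Set
  Segment a b T = StartsAt a T × EndsAt b T

  startsAt-++ : ∀ {a} {T : List V} K → StartsAt a T → StartsAt a (T ++ K)
  startsAt-++ K (start T) = start (T ++ K)

  endsAt-∷ʳ : ∀ {b} (T : List V) → EndsAt b (T ∷ʳ b)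
  endsAt-∷ʳ []      = end-here
  endsAt-∷ʳ (x ∷ T) = end-later (endsAt-∷ʳ T)

  endsAt-++⁺ʳ : ∀ {y} K {L : List V} → EndsAt y L → EndsAt y (K ++ L)
  endsAt-++⁺ʳ []      e = e
  endsAt-++⁺ʳ (x ∷ K) e = end-later (endsAt-++⁺ʳ K e)

  endsAt-++⁻ʳ : ∀ {y c} K {L : List V} → EndsAt y (K ++ c ∷ L) → EndsAt y (c ∷ L)
  endsAt-++⁻ʳ []           e             = e
  endsAt-++⁻ʳ (x ∷ [])     (end-later e) = e
  endsAt-++⁻ʳ (x ∷ x' ∷ K) (end-later e) = endsAt-++⁻ʳ (x' ∷ K) e

  endsAt-++⁻ˡ : ∀ {b y} {T K : List V} → EndsAt b T → EndsAt y (T ++ K) → EndsAt y (b ∷ K)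
  endsAt-++⁻ˡ end-here                    e             = e
  endsAt-++⁻ˡ (end-later end-here)        (end-later e) = e
  endsAt-++⁻ˡ (end-later (end-later t))   (end-later e) = endsAt-++⁻ˡ (end-later t) e

  endsAt-++⁺ˡ : ∀ {b y} {T K : List V} → EndsAt b T → EndsAt y (b ∷ K) → EndsAt y (T ++ K)
  endsAt-++⁺ˡ end-here      e = e
  endsAt-++⁺ˡ (end-later t) e = end-later (endsAt-++⁺ˡ t e)

  startsAt-splice : ∀ {a b x} K₁ {K₂ T S : List V} → Segment a b T → Segment a b S →
                    StartsAt x (K₁ ++ T ++ K₂) → StartsAt x (K₁ ++ S ++ K₂)
  startsAt-splice []       (start _ , _) (start _ , _) (start _) = start _
  startsAt-splice (k ∷ K₁) _             _             (start _) = start _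

  endsAt-splice : ∀ {a b y} K₁ {K₂ T S : List V} → Segment a b T → Segment a b S →
                  EndsAt y (K₁ ++ T ++ K₂) → EndsAt y (K₁ ++ S ++ K₂)
  endsAt-splice K₁ (start _ , eT) (start _ , eS) e =
    endsAt-++⁺ʳ K₁ (endsAt-++⁺ˡ eS (endsAt-++⁻ˡ eT (endsAt-++⁻ʳ K₁ e)))

  startsAt-reverse : ∀ {v} {P : List V} → EndsAt v P → StartsAt v (reverse P)
  startsAt-reverse end-here = start []
  startsAt-reverse {v} (end-later {x} {xs} e) =
    subst (StartsAt v) (sym (unfold-reverse x xs)) (startsAt-++ [ x ] (startsAt-reverse e))

  endsAt-reverse : ∀ {u} {P : List V} → StartsAt u P → EndsAt u (reverse P)
  endsAt-reverse {u} (start P) = subst (EndsAt u) (sym (unfold-reverse u P)) (endsAt-∷ʳ (reverse P))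

  segment-between : ∀ {a b} {Q : List V} → a ∈ Q → b ∈ Q →
    ∃₂ λ K₁ T → ∃ λ K₂ → Q ≡ K₁ ++ T ++ K₂ × (Segment a b T ⊎ Segment b a T)
  segment-between {Q = x ∷ Q} (here refl) (here refl) = [] , [ x ] , Q , refl , inj₁ (start [] , end-here)
  segment-between {b = b} {Q = x ∷ _} (here refl) (there b∈Q) with ∈-∃++ b∈Q
  ... | B , C , refl = [] , x ∷ B ∷ʳ b , C , cong (x ∷_) (sym (++-assoc B [ b ] C)) ,
                       inj₁ (start _ , endsAt-∷ʳ (x ∷ B))
  segment-between {a = a} {Q = x ∷ _} (there a∈Q) (here refl) with ∈-∃++ a∈Q
  ... | B , C , refl = [] , x ∷ B ∷ʳ a , C , cong (x ∷_) (sym (++-assoc B [ a ] C)) ,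
                       inj₂ (start _ , endsAt-∷ʳ (x ∷ B))
  segment-between {Q = x ∷ _} (there a∈Q) (there b∈Q) with segment-between a∈Q b∈Q
  ... | K₁ , T , K₂ , refl , seg = x ∷ K₁ , T , K₂ , refl , seg

  pairs-++-startsAt : ∀ {a} K {T : List V} → StartsAt a T → pairs (K ++ T) ≡ pairs (K ∷ʳ a) ++ pairs T
  pairs-++-startsAt []           (start _) = refl
  pairs-++-startsAt (x ∷ [])     (start _) = refl
  pairs-++-startsAt (x ∷ x' ∷ K) s         = cong ((x , x') ∷_) (pairs-++-startsAt (x' ∷ K) s)

  pairs-++-endsAt : ∀ {b} {T : List V} K → EndsAt b T → pairs (T ++ K) ≡ pairs T ++ pairs (b ∷ K)
  pairs-++-endsAt K end-here                                = refl
  pairs-++-endsAt K (end-later end-here)                    = refl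
  pairs-++-endsAt K (end-later {x} e@(end-later {x'} _)) = cong ((x , x') ∷_) (pairs-++-endsAt K e)

  pairs-splice : ∀ {a b} K₁ {T : List V} K₂ → Segment a b T →
                 pairs (K₁ ++ T ++ K₂) ≡ pairs (K₁ ∷ʳ a) ++ pairs T ++ pairs (b ∷ K₂)
  pairs-splice K₁ K₂ (start T , e) =
    trans (pairs-++-startsAt K₁ (start (T ++ K₂))) (cong (pairs (K₁ ∷ʳ _) ++_) (pairs-++-endsAt K₂ e))

  pairs-reverse : ∀ (L : List V) → pairs (reverse L) ≡ reverse (map swap (pairs L))
  pairs-reverse []          = refl
  pairs-reverse (x ∷ [])    = refl
  pairs-reverse (x ∷ y ∷ L) = begin
    pairs (reverse (x ∷ y ∷ L))                       ≡⟨ cong pairs (unfold-reverse x (y ∷ L)) ⟩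
    pairs (reverse (y ∷ L) ∷ʳ x)                      ≡⟨ pairs-++-endsAt [ x ] (endsAt-reverse (start L)) ⟩
    pairs (reverse (y ∷ L)) ∷ʳ (y , x)                ≡⟨ cong (_∷ʳ (y , x)) (pairs-reverse (y ∷ L)) ⟩
    reverse (map swap (pairs (y ∷ L))) ∷ʳ (y , x)     ≡⟨ unfold-reverse (y , x) (map swap (pairs (y ∷ L))) ⟨
    reverse (map swap (pairs (x ∷ y ∷ L)))            ∎
    where open ≡-Reasoning

  ∈-pairs⁻ : ∀ {c d} (L : List V) → (c , d) ∈ pairs L → c ∈ L × d ∈ L
  ∈-pairs⁻ (x ∷ y ∷ L) (here refl) = here refl , there (here refl)
  ∈-pairs⁻ (x ∷ y ∷ L) (there m)   = Product.map there there (∈-pairs⁻ (y ∷ L) m)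

  ∈-pairs-∷ʳ⁻ : ∀ {c d a} (K : List V) → (c , d) ∈ pairs (K ∷ʳ a) → c ∈ K
  ∈-pairs-∷ʳ⁻ (x ∷ [])     (here refl) = here refl
  ∈-pairs-∷ʳ⁻ (x ∷ x' ∷ K) (here refl) = here refl
  ∈-pairs-∷ʳ⁻ (x ∷ x' ∷ K) (there m)   = there (∈-pairs-∷ʳ⁻ (x' ∷ K) m)

  ∈-pairs-∷⁻ : ∀ {c d b} (K : List V) → (c , d) ∈ pairs (b ∷ K) → d ∈ K
  ∈-pairs-∷⁻ (x ∷ K) (here refl) = here refl
  ∈-pairs-∷⁻ (x ∷ K) (there m)   = there (∈-pairs-∷⁻ K m)

  ∈-pairs-++⁺ˡ : ∀ {p} (K L : List V) → p ∈ pairs K → p ∈ pairs (K ++ L)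
  ∈-pairs-++⁺ˡ (x ∷ y ∷ K) L (here eq) = here eq
  ∈-pairs-++⁺ˡ (x ∷ y ∷ K) L (there m) = there (∈-pairs-++⁺ˡ (y ∷ K) L m)

  ∈-pairs-++⁺ʳ : ∀ {p} (K L : List V) → p ∈ pairs L → p ∈ pairs (K ++ L)
  ∈-pairs-++⁺ʳ []          L       m = m
  ∈-pairs-++⁺ʳ (x ∷ [])    (y ∷ L) m = there m
  ∈-pairs-++⁺ʳ (x ∷ y ∷ K) L       m = there (∈-pairs-++⁺ʳ (y ∷ K) L m)

  ∈-pairs-reverse⁻ : ∀ {c d} (L : List V) → (c , d) ∈ pairs (reverse L) → (d , c) ∈ pairs L
  ∈-pairs-reverse⁻ L m with ∈-map⁻ swap (Any.reverse⁻ (subst ((_ , _) ∈_) (pairs-reverse L) m))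
  ... | _ , m' , refl = m'

  0<numEdges-∷-∷ʳ : ∀ x y (B : List V) → 0 < numEdges (x ∷ B ∷ʳ y)
  0<numEdges-∷-∷ʳ x y []      = s≤s z≤n
  0<numEdges-∷-∷ʳ x y (b ∷ B) = s≤s z≤n

  cost-splice : (cost : List (V × V) → ℕ) → (∀ X Y → cost (X ++ Y) ≡ cost X + cost Y) →
    ∀ {a b} K₁ {T} K₂ → Segment a b T →
    cost (pairs (K₁ ++ T ++ K₂)) ≡ cost (pairs T) + (cost (pairs (K₁ ∷ʳ a)) + cost (pairs (b ∷ K₂)))
  cost-splice cost cost-++ {a} {b} K₁ {T} K₂ seg = begin
    cost (pairs (K₁ ++ T ++ K₂))                      ≡⟨ cong cost (pairs-splice K₁ K₂ seg) ⟩
    cost (pairs (K₁ ∷ʳ a) ++ pairs T ++ pairs (b ∷ K₂)) ≡⟨ cost-++ (pairs (K₁ ∷ʳ a)) _ ⟩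
    α + cost (pairs T ++ pairs (b ∷ K₂))               ≡⟨ cong (α +_) (cost-++ (pairs T) _) ⟩
    α + (cost (pairs T) + β)                          ≡⟨ x∙yz≈y∙xz α (cost (pairs T)) β ⟩
    cost (pairs T) + (α + β)                          ∎
    where
    α = cost (pairs (K₁ ∷ʳ a))
    β = cost (pairs (b ∷ K₂))
    open ≡-Reasoning

  Unique-resp-↭ : ∀ {K L : List V} → K ↭ L → Unique K → Unique L
  Unique-resp-↭ K↭L = PermutationSetoid.Unique-resp-↭ (setoid V) (↭⇒↭ₛ K↭L)

  Unique-++⁻ˡ : ∀ (K : List V) {L} → Unique (K ++ L) → Unique K
  Unique-++⁻ˡ []      _         = []
  Unique-++⁻ˡ (x ∷ K) (x∉ ∷ u) = proj₁ (++⁻ K x∉) ∷ Unique-++⁻ˡ K u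

  Unique-++⇒Disjoint : ∀ (K : List V) {L} → Unique (K ++ L) → Disjoint K L
  Unique-++⇒Disjoint (x ∷ K) (x∉ ∷ u) (here refl , z∈L) = All.lookup (proj₂ (++⁻ K x∉)) z∈L refl
  Unique-++⇒Disjoint (x ∷ K) (x∉ ∷ u) (there z∈K , z∈L) = Unique-++⇒Disjoint K u (z∈K , z∈L)

  Unique-reverse : ∀ {L : List V} → Unique L → Unique (reverse L)
  Unique-reverse {L} = Unique-resp-↭ (↭-sym (↭-reverse L))

  Unique-infix : ∀ (K₁ : List V) {T K₂} → Unique (K₁ ++ T ++ K₂) → Unique T
  Unique-infix K₁ {T} u = Unique-++⁻ˡ T (Unique-resp-↭ (shifts K₁ T) u)

  Unique-infix-disjoint : ∀ (K₁ : List V) {T K₂} → Unique (K₁ ++ T ++ K₂) → Disjoint T (K₁ ++ K₂)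
  Unique-infix-disjoint K₁ {T} u = Unique-++⇒Disjoint T (Unique-resp-↭ (shifts K₁ T) u)

  segment-closed : ∀ {a} {R : List V} → Unique R → Segment a a R → R ≡ [ a ]
  segment-closed _ (start [] , _)                 = refl
  segment-closed u (start (_ ∷ _) , end-later e)  = ⊥-elim (Unique[x∷xs]⇒x∉xs u (endsAt⇒∈ e))
    where
    endsAt⇒∈ : ∀ {b} {L : List V} → EndsAt b L → b ∈ L
    endsAt⇒∈ end-here      = here refl
    endsAt⇒∈ (end-later e) = there (endsAt⇒∈ e)

  unique-or-loop : ∀ (L : List V) → Unique L ⊎ ∃₂ λ A c → ∃₂ λ B C → L ≡ A ++ (c ∷ B ∷ʳ c) ++ C
  unique-or-loop [] = inj₁ []
  unique-or-loop (x ∷ L) with unique-or-loop L | x ∈? L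
  ... | inj₂ (A , c , B , C , refl) | _     = inj₂ (x ∷ A , c , B , C , refl)
  ... | inj₁ u                      | no x∉L = inj₁ (¬Any⇒All¬ L x∉L ∷ u)
  ... | inj₁ _                      | yes x∈L with ∈-∃++ x∈L
  ...   | B , C , refl = inj₂ ([] , x , B , C , cong (x ∷_) (sym (++-assoc B [ x ] C)))

  infix-cancel : ∀ (K₁ : List V) {S T} K₂ → K₁ ++ S ++ K₂ ≡ K₁ ++ T ++ K₂ → S ≡ T
  infix-cancel K₁ {S} {T} K₂ eq = ++-cancelʳ K₂ S T (++-cancelˡ K₁ (S ++ K₂) (T ++ K₂) eq)

  ∈-reverse : ∀ {z} {L : List V} → z ∈ reverse L ⟺ z ∈ L
  ∈-reverse = Any.reverse⁻ , Any.reverse⁺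

  ∈-infix⁺ : ∀ {z} (K₁ : List V) {T} K₂ → z ∈ T → z ∈ K₁ ++ T ++ K₂
  ∈-infix⁺ K₁ K₂ z∈T = ∈-++⁺ʳ K₁ (∈-++⁺ˡ z∈T)

  ∈-infix⁻ : ∀ {z} (K₁ T : List V) {K₂} → z ∈ K₁ ++ T ++ K₂ → z ∈ T ⊎ z ∈ K₁ ++ K₂
  ∈-infix⁻ K₁ T m = ∈-++⁻ T (∈-resp-↭ (shifts K₁ T) m)

  ∈-context⁺ : ∀ {z} (K₁ T : List V) {K₂} → z ∈ K₁ ++ K₂ → z ∈ K₁ ++ T ++ K₂
  ∈-context⁺ K₁ T m = ∈-resp-↭ (↭-sym (shifts K₁ T)) (∈-++⁺ʳ T m)

  infix 5 _∖_
  _∖_ : List V → List V → V → Set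
  (P' ∖ P) z = z ∈ P' × z ∉ P

  ∖-reverse : ∀ {P P' : List V} z → (P' ∖ P) z ⟺ (reverse P' ∖ reverse P) z
  ∖-reverse z = (λ (z∈P' , z∉P) → proj₂ ∈-reverse z∈P' , z∉P ∘ proj₁ ∈-reverse)
              , (λ (z∈P' , z∉P) → proj₁ ∈-reverse z∈P' , z∉P ∘ proj₂ ∈-reverse)

  ∖-splice : ∀ (K₁ : List V) {T S} K₂ → Unique (K₁ ++ S ++ K₂) →
             ∀ z → ((K₁ ++ S ++ K₂) ∖ (K₁ ++ T ++ K₂)) z ⟺ (S ∖ T) z
  ∖-splice K₁ {T} {S} K₂ u z = to , from
    where
    to : ((K₁ ++ S ++ K₂) ∖ (K₁ ++ T ++ K₂)) z → (S ∖ T) z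
    to (z∈S' , z∉T') with ∈-infix⁻ K₁ S z∈S'
    ... | inj₁ z∈S = z∈S , z∉T' ∘ ∈-infix⁺ K₁ K₂
    ... | inj₂ z∈K = ⊥-elim (z∉T' (∈-context⁺ K₁ T z∈K))

    from : (S ∖ T) z → ((K₁ ++ S ++ K₂) ∖ (K₁ ++ T ++ K₂)) z
    from (z∈S , z∉T) = ∈-infix⁺ K₁ K₂ z∈S
                     , λ z∈T' → [ z∉T , (λ z∈K → Unique-infix-disjoint K₁ u (z∈S , z∈K)) ]′
                                (∈-infix⁻ K₁ T z∈T')

  IsMin-resp : ∀ {S S' : V → Set} {m} → (∀ z → S z ⟺ S' z) → IsMin S m → IsMin S' m
  IsMin-resp S⟺S' (m∈S , m≤S) = proj₁ (S⟺S' _) m∈S , λ s s∈S' → m≤S s (proj₂ (S⟺S' s) s∈S')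

  -- Subgraphs of a path and intersections

  EdgeIn-endpoints : ∀ {c d} (L : List V) → EdgeIn c d L → c ∈ L × d ∈ L
  EdgeIn-endpoints L (inj₁ m) = ∈-pairs⁻ L m
  EdgeIn-endpoints L (inj₂ m) = swap (∈-pairs⁻ L m)

  infix 4 _⊑_
  _⊑_ : List V → List V → Set
  T ⊑ Q = (∀ {z} → z ∈ T → z ∈ Q) × (∀ {c d} → EdgeIn c d T → EdgeIn c d Q)

  ⊑-trans : ∀ {R T Q : List V} → R ⊑ T → T ⊑ Q → R ⊑ Q
  ⊑-trans (vR , eR) (vT , eT) = vT ∘ vR , eT ∘ eR

  ⊑-infix : ∀ (K₁ : List V) {T} K₂ → T ⊑ K₁ ++ T ++ K₂
  ⊑-infix K₁ {T} K₂ = ∈-infix⁺ K₁ K₂ , Sum.map pair⁺ pair⁺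
    where
    pair⁺ : ∀ {p} → p ∈ pairs T → p ∈ pairs (K₁ ++ T ++ K₂)
    pair⁺ = ∈-pairs-++⁺ʳ K₁ (T ++ K₂) ∘ ∈-pairs-++⁺ˡ T K₂

  ⊑-reverse : ∀ {T : List V} → reverse T ⊑ T
  ⊑-reverse {T} = proj₁ ∈-reverse , Sum.swap ∘ Sum.map (∈-pairs-reverse⁻ T) (∈-pairs-reverse⁻ T)

  ⊑-singleton : ∀ {a} {Q : List V} → a ∈ Q → [ a ] ⊑ Q
  ⊑-singleton a∈Q = (λ { (here refl) → a∈Q }) , λ { (inj₁ ()) ; (inj₂ ()) }

  Intersection : List V → List V → List V → Set
  Intersection R P Q = (∀ z → z ∈ R ⟺ (z ∈ P × z ∈ Q))
                     × (∀ c d → EdgeIn c d R ⟺ (EdgeIn c d P × EdgeIn c d Q))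

  intersection-trimmed : ∀ {a b} {Q : List V} L₁ {R} L₂ → Segment a b R →
    All (_∉ Q) L₁ → All (_∉ Q) L₂ → R ⊑ Q → Intersection R (L₁ ++ R ++ L₂) Q
  intersection-trimmed {a} {Q = Q} L₁ {R} L₂ seg out₁ out₂ (vR , eR) = vertices , edges
    where
    vertices : ∀ z → z ∈ R ⟺ (z ∈ L₁ ++ R ++ L₂ × z ∈ Q)
    vertices z = (λ z∈R → ∈-infix⁺ L₁ L₂ z∈R , vR z∈R)
               , λ (z∈P , z∈Q) → [ (λ z∈R → z∈R) , (λ z∈L → ⊥-elim (outside z∈L z∈Q)) ]′
                                   (∈-infix⁻ L₁ R z∈P)
      where
      outside : z ∈ L₁ ++ L₂ → z ∉ Q
      outside z∈L = [ All.lookup out₁ , All.lookup out₂ ]′ (∈-++⁻ L₁ z∈L)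

    pair-inside : ∀ {c d} → c ∈ Q → d ∈ Q → (c , d) ∈ pairs (L₁ ++ R ++ L₂) → (c , d) ∈ pairs R
    pair-inside c∈Q d∈Q m with ∈-++⁻ (pairs (L₁ ∷ʳ a)) (subst (_ ∈_) (pairs-splice L₁ L₂ seg) m)
    ... | inj₁ m₁ = ⊥-elim (All.lookup out₁ (∈-pairs-∷ʳ⁻ L₁ m₁) c∈Q)
    ... | inj₂ m₂ with ∈-++⁻ (pairs R) m₂
    ...   | inj₁ m₂₁ = m₂₁
    ...   | inj₂ m₂₂ = ⊥-elim (All.lookup out₂ (∈-pairs-∷⁻ L₂ m₂₂) d∈Q)

    edge-inside : ∀ {c d} → c ∈ Q × d ∈ Q → EdgeIn c d (L₁ ++ R ++ L₂) → EdgeIn c d R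
    edge-inside (c∈Q , d∈Q) (inj₁ m) = inj₁ (pair-inside c∈Q d∈Q m)
    edge-inside (c∈Q , d∈Q) (inj₂ m) = inj₂ (pair-inside d∈Q c∈Q m)

    edges : ∀ c d → EdgeIn c d R ⟺ (EdgeIn c d (L₁ ++ R ++ L₂) × EdgeIn c d Q)
    edges c d = (λ e → proj₂ (⊑-infix L₁ L₂) e , eR e)
              , λ (eP , eQ) → edge-inside (EdgeIn-endpoints Q eQ) eP

  disjoint-or-meet : ∀ (P Q : List V) → (∀ z → ¬ (z ∈ P × z ∈ Q)) ⊎ Any (_∈ Q) P
  disjoint-or-meet P Q with any? (_∈? Q) P
  ... | yes meet = inj₂ meet
  ... | no  none = inj₁ λ z (z∈P , z∈Q) → none (lose z∈P z∈Q)

  first-meet : ∀ (Q P : List V) → Any (_∈ Q) P →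
    ∃₂ λ L₁ a → ∃ λ M → P ≡ L₁ ++ a ∷ M × a ∈ Q × All (_∉ Q) L₁
  first-meet Q (x ∷ P) meet with x ∈? Q | meet
  ... | yes x∈Q | _           = [] , x , P , refl , x∈Q , []
  ... | no x∉Q  | here x∈Q    = ⊥-elim (x∉Q x∈Q)
  ... | no x∉Q  | there meet′ with first-meet Q P meet′
  ...   | L₁ , a , M , refl , a∈Q , out = x ∷ L₁ , a , M , refl , a∈Q , x∉Q ∷ out

  last-meet : ∀ (Q : List V) x L → Any (_∈ Q) (x ∷ L) →
    ∃₂ λ R b → ∃ λ L₂ → x ∷ L ≡ R ++ L₂ × Segment x b R × b ∈ Q × All (_∉ Q) L₂
  last-meet Q x L meet with any? (_∈? Q) L
  last-meet Q x [] meet | yes ()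
  last-meet Q x (y ∷ L) meet | yes meet′ with last-meet Q y L meet′
  ... | R , b , L₂ , eq , (_ , e) , b∈Q , out =
    x ∷ R , b , L₂ , cong (x ∷_) eq , (start R , end-later e) , b∈Q , out
  last-meet Q x L meet | no none =
    [ x ] , x , L , refl , (start [] , end-here) , [ (λ x∈Q → x∈Q) , ⊥-elim ∘ none ]′ (toSum meet) ,
    ¬Any⇒All¬ L none

  trim : ∀ (Q P : List V) → Any (_∈ Q) P →
    ∃₂ λ L₁ R → ∃₂ λ L₂ a → ∃ λ b →
      P ≡ L₁ ++ R ++ L₂ × Segment a b R × a ∈ Q × b ∈ Q × All (_∉ Q) L₁ × All (_∉ Q) L₂
  trim Q P meet with first-meet Q P meet
  ... | L₁ , a , M , refl , a∈Q , out₁ with last-meet Q a M (here a∈Q)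
  ...   | R , b , L₂ , eq , seg , b∈Q , out₂ =
          L₁ , R , L₂ , a , b , cong (L₁ ++_) eq , seg , a∈Q , b∈Q , out₁ , out₂

module LexShortestPaths {n : ℕ} (G : Graph n) (w : Fin n → Fin n → ℕ) where
  private
    V = Fin n

  IsEdge : V × V → Set
  IsEdge e = Adj G (proj₁ e) (proj₂ e)

  edgeWeight : V × V → ℕ
  edgeWeight e = w (proj₁ e) (proj₂ e)

  WeightSymmetric : Set
  WeightSymmetric = ∀ a b → Adj G a b → w a b ≡ w b a

  record Extends (k l : ℕ) (T P : List V) : Set where
    constructor extends
    field
      weight-≡   : weight w P ≡ weight w T + k
      numEdges-≡ : numEdges P ≡ numEdges T + l

  splice-extends : ∀ {a b} K₁ {T} K₂ → Segment a b T →
    Extends (weight w (K₁ ∷ʳ a) + weight w (b ∷ K₂)) (numEdges (K₁ ∷ʳ a) + numEdges (b ∷ K₂))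
            T (K₁ ++ T ++ K₂)
  splice-extends K₁ K₂ seg = extends (cost-splice (sum ∘ map edgeWeight) weights-++ K₁ K₂ seg)
                                     (cost-splice length (λ X Y → length-++ X) K₁ K₂ seg)
    where
    weights-++ : ∀ X Y → sum (map edgeWeight (X ++ Y)) ≡ sum (map edgeWeight X) + sum (map edgeWeight Y)
    weights-++ X Y = trans (cong sum (map-++ edgeWeight X Y)) (sum-++ (map edgeWeight X) _)

  weight-reverse : WeightSymmetric → ∀ {P} → All IsEdge (pairs P) → weight w (reverse P) ≡ weight w P
  weight-reverse w-sym {P} adj = begin
    sum (map edgeWeight (pairs (reverse P)))         ≡⟨ cong (sum ∘ map edgeWeight) (pairs-reverse P) ⟩
    sum (map edgeWeight (reverse (map swap ps)))     ≡⟨ cong sum (reverse-map edgeWeight (map swap ps)) ⟩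
    sum (reverse (map edgeWeight (map swap ps)))     ≡⟨ sum-↭ (↭-reverse (map edgeWeight (map swap ps))) ⟩
    sum (map edgeWeight (map swap ps))               ≡⟨ cong sum (map-∘ ps) ⟨
    sum (map (edgeWeight ∘ swap) ps)                 ≡⟨ cong sum (map-cong-local (All.map swap-weight adj)) ⟩
    sum (map edgeWeight ps)                          ∎
    where
    ps = pairs P
    swap-weight : ∀ {e} → IsEdge e → edgeWeight (swap e) ≡ edgeWeight e
    swap-weight {a , b} ab = sym (w-sym a b ab)
    open ≡-Reasoning

  numEdges-reverse : ∀ (P : List V) → numEdges (reverse P) ≡ numEdges P
  numEdges-reverse P = begin
    length (pairs (reverse P))              ≡⟨ cong length (pairs-reverse P) ⟩
    length (reverse (map swap (pairs P)))   ≡⟨ length-reverse (map swap (pairs P)) ⟩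
    length (map swap (pairs P))             ≡⟨ length-map swap (pairs P) ⟩
    length (pairs P)                        ∎
    where open ≡-Reasoning

  reverse-extends : WeightSymmetric → ∀ {P} → All IsEdge (pairs P) → Extends 0 0 (reverse P) P
  reverse-extends w-sym {P} adj = extends (sym (trans (+-identityʳ _) (weight-reverse w-sym adj)))
                                          (sym (trans (+-identityʳ _) (numEdges-reverse P)))

  -- Comparing by weight, then by number of edges

  infix 4 _≺_ _≼_ _⊏_
  _≺_ : List V → List V → Set
  P ≺ P' = weight w P < weight w P' ⊎ (weight w P ≡ weight w P' × numEdges P < numEdges P')

  _≼_ : List V → List V → Set
  P ≼ P' = weight w P < weight w P' ⊎ (weight w P ≡ weight w P' × numEdges P ≤ numEdges P')

  record _⊏_ (W' W : List V) : Set where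
    constructor mk⊏
    field
      weight-≤   : weight w W' ≤ weight w W
      numEdges-< : numEdges W' < numEdges W

  ≺⇒LexWorse : ∀ {P P'} → P ≺ P' → LexWorse w P P'
  ≺⇒LexWorse (inj₁ lighter)  = inj₁ lighter
  ≺⇒LexWorse (inj₂ shorter) = inj₂ (inj₁ shorter)

  LexWorse⇒≼ : ∀ {P P'} → LexWorse w P P' → P ≼ P'
  LexWorse⇒≼ (inj₁ lighter)                    = inj₁ lighter
  LexWorse⇒≼ (inj₂ (inj₁ (same , shorter)))   = inj₂ (same , <⇒≤ shorter)
  LexWorse⇒≼ (inj₂ (inj₂ (same , same′ , _))) = inj₂ (same , ≤-reflexive same′)

  ≼-⊏-trans : ∀ {P W' W} → P ≼ W' → W' ⊏ W → P ≺ W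
  ≼-⊏-trans (inj₁ lighter) (mk⊏ w≤ _) = inj₁ (<-≤-trans lighter w≤)
  ≼-⊏-trans (inj₂ (same , e≤)) (mk⊏ w≤ e<) with m≤n⇒m<n∨m≡n w≤
  ... | inj₁ lighter = inj₁ (≤-<-trans (≤-reflexive same) lighter)
  ... | inj₂ same′   = inj₂ (trans same same′ , ≤-<-trans e≤ e<)

  ⊏-trans : ∀ {W'' W' W} → W'' ⊏ W' → W' ⊏ W → W'' ⊏ W
  ⊏-trans (mk⊏ w≤′ e<′) (mk⊏ w≤ e<) = mk⊏ (≤-trans w≤′ w≤) (<-trans e<′ e<)

  private
    cancel-< : ∀ {k x y u v} → u ≡ x + k → v ≡ y + k → u < v → x < y
    cancel-< {k} refl refl = +-cancelʳ-< k _ _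

    cancel-≡ : ∀ {k x y u v} → u ≡ x + k → v ≡ y + k → u ≡ v → x ≡ y
    cancel-≡ {k} refl refl = +-cancelʳ-≡ k _ _

  ≺-cancel : ∀ {k l T S P P'} → Extends k l T P → Extends k l S P' → P ≺ P' → T ≺ S
  ≺-cancel (extends wT _) (extends wS _) (inj₁ lighter) = inj₁ (cancel-< wT wS lighter)
  ≺-cancel (extends wT eT) (extends wS eS) (inj₂ (same , shorter)) =
    inj₂ (cancel-≡ wT wS same , cancel-< eT eS shorter)

  LexWorse-cancel : ∀ {k l T S P P'} → Extends k l T P → Extends k l S P' →
    (∀ z → (P' ∖ P) z ⟺ (S ∖ T) z) → (∀ z → (P ∖ P') z ⟺ (T ∖ S) z) →
    LexWorse w P P' → LexWorse w T S
  LexWorse-cancel extT extS _ _ (inj₁ lighter) = ≺⇒LexWorse (≺-cancel extT extS (inj₁ lighter))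
  LexWorse-cancel extT extS _ _ (inj₂ (inj₁ shorter)) = ≺⇒LexWorse (≺-cancel extT extS (inj₂ shorter))
  LexWorse-cancel (extends wT eT) (extends wS eS) new old
                  (inj₂ (inj₂ (same , same′ , a , b , min-new , min-old , b<a))) =
    inj₂ (inj₂ (cancel-≡ wT wS same , cancel-≡ eT eS same′ , a , b ,
                IsMin-resp new min-new , IsMin-resp old min-old , b<a))

  LexWorse-asym : ∀ {P P'} → LexWorse w P P' → LexWorse w P' P → ⊥
  LexWorse-asym (inj₁ x) (inj₁ y) = <-asym x y
  LexWorse-asym (inj₁ x) (inj₂ (inj₁ (e , _))) = <-irrefl (sym e) x
  LexWorse-asym (inj₁ x) (inj₂ (inj₂ (e , _))) = <-irrefl (sym e) x
  LexWorse-asym (inj₂ (inj₁ (e , _))) (inj₁ y) = <-irrefl (sym e) y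
  LexWorse-asym (inj₂ (inj₂ (e , _))) (inj₁ y) = <-irrefl (sym e) y
  LexWorse-asym (inj₂ (inj₁ (_ , x))) (inj₂ (inj₁ (_ , y))) = <-asym x y
  LexWorse-asym (inj₂ (inj₁ (_ , x))) (inj₂ (inj₂ (_ , e , _))) = <-irrefl (sym e) x
  LexWorse-asym (inj₂ (inj₂ (_ , e , _))) (inj₂ (inj₁ (_ , y))) = <-irrefl (sym e) y
  LexWorse-asym (inj₂ (inj₂ (_ , _ , a , b , (a∈ , a≤) , (b∈ , b≤) , b<a)))
                (inj₂ (inj₂ (_ , _ , a' , b' , (a'∈ , a'≤) , (b'∈ , b'≤) , b'<a'))) =
    <-irrefl refl (<-≤-trans b<a (≤-trans (a≤ b' b'∈) (<⇒≤ (<-≤-trans b'<a' (a'≤ b b∈)))))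

  -- Walks and shortcuts

  Walk : V → V → List V → Set
  Walk x y W = StartsAt x W × EndsAt y W × All IsEdge (pairs W)

  path⇒walk : ∀ {x y P} → IsPath G x y P → Walk x y P
  path⇒walk (s , e , _ , adj) = s , e , adj

  walk⇒path : ∀ {x y W} → Unique W → Walk x y W → IsPath G x y W
  walk⇒path u (s , e , adj) = s , e , u , adj

  edges-splice⁻ : ∀ {a b} K₁ {T} K₂ → Segment a b T → All IsEdge (pairs (K₁ ++ T ++ K₂)) →
    All IsEdge (pairs (K₁ ∷ʳ a)) × All IsEdge (pairs T) × All IsEdge (pairs (b ∷ K₂))
  edges-splice⁻ {a} K₁ {T} K₂ seg adj
    with adj₁ , adj₂₃ ← ++⁻ (pairs (K₁ ∷ʳ a)) (subst (All IsEdge) (pairs-splice K₁ K₂ seg) adj) =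
    adj₁ , ++⁻ (pairs T) adj₂₃

  walk-splice : ∀ {x y a b} K₁ {T S} K₂ → Segment a b T → Walk a b S →
    Walk x y (K₁ ++ T ++ K₂) → Walk x y (K₁ ++ S ++ K₂)
  walk-splice K₁ K₂ segT (sS , eS , adjS) (s , e , adj)
    with adj₁ , _ , adj₃ ← edges-splice⁻ K₁ K₂ segT adj =
    startsAt-splice K₁ segT (sS , eS) s , endsAt-splice K₁ segT (sS , eS) e ,
    subst (All IsEdge) (sym (pairs-splice K₁ K₂ (sS , eS))) (++⁺ adj₁ (++⁺ adjS adj₃))

  path-infix : ∀ {x y a b} K₁ {T} K₂ → Segment a b T → IsPath G x y (K₁ ++ T ++ K₂) → IsPath G a b T
  path-infix K₁ K₂ (sT , eT) (_ , _ , u , adj) =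
    sT , eT , Unique-infix K₁ u , proj₁ (proj₂ (edges-splice⁻ K₁ K₂ (sT , eT) adj))

  path-reverse : ∀ {x y P} → IsPath G x y P → IsPath G y x (reverse P)
  path-reverse {P = P} (s , e , u , adj) =
    startsAt-reverse e , endsAt-reverse s , Unique-reverse u ,
    All.tabulate (λ m → Adj-sym G (All.lookup adj (∈-pairs-reverse⁻ P m)))

  shortcut-loop : ∀ {x y} A c B C → Walk x y (A ++ (c ∷ B ∷ʳ c) ++ C) →
    Walk x y (A ++ [ c ] ++ C) × (A ++ [ c ] ++ C) ⊏ (A ++ (c ∷ B ∷ʳ c) ++ C)
  shortcut-loop A c B C walk =
    walk-splice A C seg-loop (start [] , end-here , []) walk ,
    mk⊏ (subst₂ _≤_ (sym wc) (sym wl) (m≤n+m _ (weight w (c ∷ B ∷ʳ c))))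
        (subst₂ _<_ (sym ec) (sym el) (+-monoˡ-< _ (0<numEdges-∷-∷ʳ c c B)))
    where
    seg-loop : Segment c c (c ∷ B ∷ʳ c)
    seg-loop = start _ , endsAt-∷ʳ (c ∷ B)
    open Extends (splice-extends A C seg-loop) renaming (weight-≡ to wl; numEdges-≡ to el)
    open Extends (splice-extends A C (start [] , end-here)) renaming (weight-≡ to wc; numEdges-≡ to ec)

  shortcut-to-path : ∀ {x y} W → Walk x y W → Unique W ⊎ ∃ λ W' → IsPath G x y W' × W' ⊏ W
  shortcut-to-path W = go W (<-wellFounded (numEdges W))
    where
    go : ∀ {x y} W → Acc _<_ (numEdges W) → Walk x y W → Unique W ⊎ ∃ λ W' → IsPath G x y W' × W' ⊏ W
    go W (acc smaller) walk with unique-or-loop W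
    ... | inj₁ u = inj₁ u
    ... | inj₂ (A , c , B , C , refl) with shortcut-loop A c B C walk
    ...   | walk' , W'⊏W with go (A ++ [ c ] ++ C) (smaller (_⊏_.numEdges-< W'⊏W)) walk'
    ...     | inj₁ u' = inj₂ (_ , walk⇒path u' walk' , W'⊏W)
    ...     | inj₂ (W'' , path'' , W''⊏W') = inj₂ (W'' , path'' , ⊏-trans W''⊏W' W'⊏W)

  -- Lex shortest paths

  lsp-≼ : ∀ {x y P W} → IsLSP G w x y P → IsPath G x y W → P ≼ W
  lsp-≼ {P = P} {W} (_ , _ , optimal) pathW with ≡-dec _≟_ W P
  ... | yes refl = inj₂ (refl , ≤-refl)
  ... | no W≢P   = LexWorse⇒≼ (optimal W pathW W≢P)

  lsp-unique : ∀ {a b R T} → IsLSP G w a b R → IsLSP G w a b T → R ≡ T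
  lsp-unique {R = R} {T} (_ , pathR , optimalR) (_ , pathT , optimalT) with ≡-dec _≟_ R T
  ... | yes R≡T = R≡T
  ... | no R≢T  = ⊥-elim (LexWorse-asym (optimalR T pathT (R≢T ∘ sym)) (optimalT R pathR R≢T))

  lsp-infix : ∀ {x y a b} K₁ {T} K₂ → IsLSP G w x y (K₁ ++ T ++ K₂) → Segment a b T → a ≢ b →
              IsLSP G w a b T
  lsp-infix K₁ {T} K₂ lspP@(_ , pathP@(_ , _ , uniqueP , _) , optimal) segT a≢b =
    a≢b , path-infix K₁ K₂ segT pathP , beats
    where
    beats : ∀ S → IsPath G _ _ S → S ≢ T → LexWorse w T S
    beats S (sS , eS , _ , adjS) S≢T
      with walkW ← walk-splice K₁ K₂ segT (sS , eS , adjS) (path⇒walk pathP)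
      with shortcut-to-path (K₁ ++ S ++ K₂) walkW
    ... | inj₁ uniqueW =
      LexWorse-cancel (splice-extends K₁ K₂ segT) (splice-extends K₁ K₂ (sS , eS))
        (∖-splice K₁ K₂ uniqueW) (∖-splice K₁ K₂ uniqueP)
        (optimal _ (walk⇒path uniqueW walkW) (S≢T ∘ infix-cancel K₁ K₂))
    ... | inj₂ (W' , pathW' , W'⊏W) =
      ≺⇒LexWorse (≺-cancel (splice-extends K₁ K₂ segT) (splice-extends K₁ K₂ (sS , eS))
                             (≼-⊏-trans {P = K₁ ++ T ++ K₂} (lsp-≼ lspP pathW') W'⊏W))

  LexWorse-reverse : WeightSymmetric → ∀ {P P'} → All IsEdge (pairs P) → All IsEdge (pairs P') →
                     LexWorse w P P' → LexWorse w (reverse P) (reverse P')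
  LexWorse-reverse w-sym adjP adjP' =
    LexWorse-cancel (reverse-extends w-sym adjP) (reverse-extends w-sym adjP') ∖-reverse ∖-reverse

  lsp-reverse : WeightSymmetric → ∀ {x y P} → IsLSP G w x y P → IsLSP G w y x (reverse P)
  lsp-reverse w-sym {P = P} (x≢y , pathP@(_ , _ , _ , adjP) , optimal) =
    x≢y ∘ sym , path-reverse pathP , beats
    where
    beats : ∀ S → IsPath G _ _ S → S ≢ reverse P → LexWorse w (reverse P) S
    beats S pathS S≢P′ = subst (LexWorse w (reverse P)) (reverse-involutive S)
      (LexWorse-reverse w-sym adjP adjS′ (optimal (reverse S) pathS′ S′≢P))
      where
      pathS′ = path-reverse pathS
      adjS′ = proj₂ (proj₂ (path⇒walk pathS′))
      S′≢P : reverse S ≢ P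
      S′≢P eq = S≢P′ (trans (sym (reverse-involutive S)) (cong reverse eq))

  lsp-within : WeightSymmetric → ∀ {u v a b Q} → IsLSP G w u v Q → a ∈ Q → b ∈ Q → a ≢ b →
               ∃ λ T → IsLSP G w a b T × T ⊑ Q
  lsp-within w-sym lspQ a∈Q b∈Q a≢b with segment-between a∈Q b∈Q
  ... | K₁ , T , K₂ , refl , inj₁ segT = T , lsp-infix K₁ K₂ lspQ segT a≢b , ⊑-infix K₁ K₂
  ... | K₁ , T , K₂ , refl , inj₂ segT =
    reverse T , lsp-reverse w-sym (lsp-infix K₁ K₂ lspQ segT (a≢b ∘ sym)) ,
    ⊑-trans ⊑-reverse (⊑-infix K₁ K₂)

  lsp-intersection : WeightSymmetric → ∀ {x y u v P Q} → IsLSP G w x y P → IsLSP G w u v Q →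
    (∀ z → ¬ (z ∈ P × z ∈ Q))
    ⊎ ∃ λ R → ((∃ λ z → R ≡ [ z ]) ⊎ (∃₂ λ a b → IsLSP G w a b R)) × Intersection R P Q
  lsp-intersection w-sym {P = P} {Q} lspP@(_ , (_ , _ , uniqueP , _) , _) lspQ with disjoint-or-meet P Q
  ... | inj₁ disjoint = inj₁ disjoint
  ... | inj₂ meet
    with L₁ , R , L₂ , a , b , refl , segR , a∈Q , b∈Q , out₁ , out₂ ← trim Q P meet
    with a ≟ b
  ... | yes refl =
    let R≡[a] = segment-closed (Unique-infix L₁ uniqueP) segR
    in inj₂ (R , inj₁ (a , R≡[a]) ,
             intersection-trimmed L₁ L₂ segR out₁ out₂ (subst (_⊑ Q) (sym R≡[a]) (⊑-singleton a∈Q)))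
  ... | no a≢b
    with T , lspT , T⊑Q ← lsp-within w-sym lspQ a∈Q b∈Q a≢b =
    let lspR = lsp-infix L₁ L₂ lspP segR a≢b
    in inj₂ (R , inj₂ (a , b , lspR) ,
             intersection-trimmed L₁ L₂ segR out₁ out₂ (subst (_⊑ Q) (sym (lsp-unique lspR lspT)) T⊑Q))

lemma6 : ∀ {n} (G : Graph n) (w : Fin n → Fin n → ℕ)
         → (∀ a b → Adj G a b → w a b ≡ w b a)
         → Connected G
         → ∀ x y u v (P Q : List (Fin n))
         → IsLSP G w x y P → IsLSP G w u v Q
         → (∀ z → ¬ (z ∈ P × z ∈ Q))
           ⊎ (Σ (List (Fin n)) λ R →
                ((∃ λ z → R ≡ z ∷ []) ⊎ (∃₂ λ a b → IsLSP G w a b R))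
                × (∀ z → z ∈ R ⟺ (z ∈ P × z ∈ Q))
                × (∀ a b → EdgeIn a b R ⟺ (EdgeIn a b P × EdgeIn a b Q)))
lemma6 G w w-sym _ x y u v P Q = LexShortestPaths.lsp-intersection G w w-sym
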